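{- Let $p$ be a prime and $S$ an association scheme on a finite set $X$ such that $p\mid k_i$ for every $R_i\in S\setminus O_\vartheta(S)$. If $p\nmid |X|$, then $S=O^\vartheta(S)O_\vartheta(S)$; in particular, $S$ is the unique strongly normal closed subset of $S$ containing $O_\vartheta(S)$.
   Context: $S=\{R_0,\dots,R_d\}$ is an association scheme on $X$ with diagonal $R_0$, transposes $R_{i^*}$, intersection numbers $p_{ij}^k$, valencies $k_i=p_{ii^*}^0$. For nonempty $U,V\subseteq S$, $UV=\{R_k:\exists R_u\in U,R_v\in V,\ p_{uv}^k>0\}$ ($R_i$ stands for $\{R_i\}$). A nonempty $T\subseteq S$ is closed if $T^*T\subseteq T$ ($T^*=\{R_{i^*}:R_i\in T\}$), strongly normal if also $R_{i^*}TR_i\subseteq T$ for all $i$. $O_\vartheta(S)=\{R_i:k_i=1\}$ (thin radical); $O^\vartheta(S)$ is the intersection of all strongly normal closed subsets (thin residue). -}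

module Defs where

open import Data.Nat using (ℕ; zero; suc; _+_; _<_)
open import Data.Bool using (Bool; true; false; _∧_)
open import Data.Fin using (Fin; zero; suc; _≟_)
open import Data.Fin.Subset using (Subset; _∈_; Nonempty)
open import Data.Product using (Σ; ∃; ∃-syntax; _×_; _,_)
open import Relation.Nullary.Decidable using (⌊_⌋)
open import Relation.Binary.PropositionalEquality using (_≡_)
open import Function.Bundles using (_⇔_)

b2n : Bool → ℕ
b2n true  = 1
b2n false = 0

count : (n : ℕ) → (Fin n → Bool) → ℕ
count zero    f = 0
count (suc n) f = b2n (f zero) + count n (λ z → f (suc z))

-- An association scheme S = {R_0, …, R_d} on the finite set X = Fin n.
-- The relations are encoded by the map  rel : X → X → Fin (suc d),
-- where (x , y) ∈ R_i  iff  rel x y ≡ i.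
record AssocScheme : Set where
  field
    n     : ℕ
    d     : ℕ
    rel   : Fin n → Fin n → Fin (suc d)
    diag  : ∀ x y → rel x y ≡ zero ⇔ x ≡ y
    nonempty : ∀ i → ∃[ x ] ∃[ y ] rel x y ≡ i
    star  : Fin (suc d) → Fin (suc d)
    trans : ∀ x y → rel y x ≡ star (rel x y)
    p     : Fin (suc d) → Fin (suc d) → Fin (suc d) → ℕ
    inter : ∀ i j x y →
            count n (λ z → ⌊ rel x z ≟ i ⌋ ∧ ⌊ rel z y ≟ j ⌋) ≡ p i j (rel x y)

  k : Fin (suc d) → ℕ
  k i = p i (star i) zero

  _·_ : (Fin (suc d) → Set) → (Fin (suc d) → Set) → (Fin (suc d) → Set)
  (U · V) l = ∃[ u ] ∃[ v ] (U u × V v × 0 < p u v l)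

  mem : Subset (suc d) → Fin (suc d) → Set
  mem T i = i ∈ T

  memStar : Subset (suc d) → Fin (suc d) → Set
  memStar T i = star i ∈ T

  sing : Fin (suc d) → Fin (suc d) → Set
  sing i j = j ≡ i

  Closed : Subset (suc d) → Set
  Closed T = Nonempty T × (∀ l → (memStar T · mem T) l → l ∈ T)

  StronglyNormalClosed : Subset (suc d) → Set
  StronglyNormalClosed T =
    Closed T × (∀ i l → ((sing (star i) · mem T) · sing i) l → l ∈ T)

  thinRadical : Fin (suc d) → Set
  thinRadical i = k i ≡ 1

  thinResidue : Fin (suc d) → Set
  thinResidue i = ∀ (T : Subset (suc d)) → StronglyNormalClosed T → i ∈ T

-- Let N = O^θ(S). The relation "R(x,z) ∈ N" is an equivalence on X whose classes all have
-- the same size Σ_{R_w ∈ N} k_w. If some R(x,y) is not in N O_θ(S), sort the class of x by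
-- the relation R(y,z): by strong normality each nonempty part is a whole fibre
-- {z : R(y,z) = R_w} of size k_w with R_w not thin, so p divides the class size and hence
-- |X|. Any strongly normal closed subset containing O_θ(S) then contains N O_θ(S) = S.
module Submission where

open import Defs
open import Level using (Level)
open import Data.Nat using (ℕ; zero; suc; _+_; _*_; _<_; z≤n; s≤s)
open import Data.Nat.Properties
  using (+-0-commutativeMonoid; *-identityˡ; *-identityʳ; *-cancelˡ-≡; m≤n+m; ≤-trans)
import Data.Nat as ℕ
open import Data.Nat.Divisibility using (_∣_; _∤_; _∣0; ∣m∣n⇒∣m+n; ∣n⇒∣m*n)
open import Data.Nat.Primality using (Prime)
open import Algebra.Properties.CommutativeMonoid.Sum +-0-commutativeMonoid
  using (sum-syntax; sum-cong-≗; ∑-comm)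
open import Data.Bool using (Bool; true; false; _∧_)
open import Data.Bool.Properties using (∧-identityʳ; ∧-zeroʳ)
open import Data.Fin using (Fin; zero; suc; _≟_)
import Data.Fin as Fin
open import Data.Fin.Properties using (any?; all?; nonZeroIndex)
import Data.Fin.Properties as Fin
open import Data.Fin.Subset using (Subset; _∈_; ⊤)
open import Data.Fin.Subset.Properties using (_∈?_; nonempty?; anySubset?; ∈⊤; ⊆-antisym)
open import Data.Product using (∃-syntax; _×_; _,_; proj₁; proj₂)
open import Data.Empty using (⊥-elim)
open import Function using (_∘_; _⇔_; mk⇔; Equivalence)
open import Relation.Nullary using (¬_; yes; no; does)
open import Relation.Nullary.Decidable
  using (isYes≗does; dec-true; dec-false; does-⇔; _×-dec_; _→-dec_; ¬?; decidable-stable)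
open import Relation.Unary using (Pred; Decidable)
open import Relation.Binary using (Rel; IsEquivalence)
open import Relation.Binary.Definitions using () renaming (Decidable to Decidable₂)
open import Relation.Binary.PropositionalEquality
  using (_≡_; _≗_; refl; sym; trans; cong; cong₂; subst)
open Relation.Binary.PropositionalEquality.≡-Reasoning

private
  variable
    ℓ : Level

count-cong : ∀ {n} {f g : Fin n → Bool} → f ≗ g → count n f ≡ count n g
count-cong {zero}  _   = refl
count-cong {suc n} f≗g = cong₂ _+_ (cong b2n (f≗g zero)) (count-cong (f≗g ∘ suc))

count≡∑ : ∀ n (f : Fin n → Bool) → count n f ≡ ∑[ z < n ] b2n (f z)
count≡∑ zero    f = refl
count≡∑ (suc n) f = cong (b2n (f zero) +_) (count≡∑ n (f ∘ suc))

count-false : ∀ {n} {f : Fin n → Bool} → (∀ z → f z ≡ false) → count n f ≡ 0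
count-false {zero}          _       = refl
count-false {suc n} {f} f≡false rewrite f≡false zero = count-false (f≡false ∘ suc)

count-≟ : ∀ {n} (a : Fin n) → count n (λ z → does (z ≟ a)) ≡ 1
count-≟ {suc n} zero    = cong suc (count-false {n} (λ _ → refl))
count-≟ {suc n} (suc a) = trans
  (count-cong (λ z → does-⇔ (mk⇔ Fin.suc-injective (cong suc)) (suc z ≟ suc a) (z ≟ a)))
  (count-≟ a)

count-unique : ∀ {n} {P : Pred (Fin n) ℓ} (P? : Decidable P) (a : Fin n) →
               (∀ z → P z ⇔ z ≡ a) → count n (does ∘ P?) ≡ 1
count-unique P? a P⇔≡a =
  trans (count-cong (λ z → does-⇔ (P⇔≡a z) (P? z) (z ≟ a))) (count-≟ a)

count-pos : ∀ {n} {P : Pred (Fin n) ℓ} (P? : Decidable P) {z : Fin n} →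
            P z → 0 < count n (does ∘ P?)
count-pos P? {zero} Pz with P? zero
... | yes _  = s≤s z≤n
... | no ¬P₀ = ⊥-elim (¬P₀ Pz)
count-pos {n = suc n} P? {suc z} Pz = ≤-trans (count-pos (P? ∘ suc) Pz) (m≤n+m _ _)

count-∧-const : ∀ {n} (f : Fin n → Bool) (b : Bool) →
                count n (λ z → f z ∧ b) ≡ b2n b * count n f
count-∧-const f true  = trans (count-cong (∧-identityʳ ∘ f)) (sym (*-identityˡ _))
count-∧-const f false = count-false (∧-zeroʳ ∘ f)

∑-const : ∀ n c → ∑[ i < n ] c ≡ n * c
∑-const zero    c = refl
∑-const (suc n) c = cong (c +_) (∑-const n c)

∑-∣ : ∀ {q n} {f : Fin n → ℕ} → (∀ i → q ∣ f i) → q ∣ ∑[ i < n ] f i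
∑-∣ {q} {zero}  _   = q ∣0
∑-∣ {q} {suc n} q∣f = ∣m∣n⇒∣m+n (q∣f zero) (∑-∣ (q∣f ∘ suc))

count-fibres : ∀ {n m} (g : Fin n → Fin m) (f : Fin n → Bool) →
               count n f ≡ ∑[ w < m ] count n (λ z → does (g z ≟ w) ∧ f z)
count-fibres {n} {m} g f = begin
  count n f
    ≡⟨ count≡∑ n f ⟩
  ∑[ z < n ] b2n (f z)
    ≡⟨ sum-cong-≗ {n} (sym ∘ indicator) ⟩
  ∑[ z < n ] ∑[ w < m ] b2n (does (g z ≟ w) ∧ f z)
    ≡⟨ ∑-comm {n} {m} _ ⟩
  ∑[ w < m ] ∑[ z < n ] b2n (does (g z ≟ w) ∧ f z)
    ≡⟨ sum-cong-≗ {m} (λ w → sym (count≡∑ n (λ z → does (g z ≟ w) ∧ f z))) ⟩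
  ∑[ w < m ] count n (λ z → does (g z ≟ w) ∧ f z) ∎
  where
  indicator : ∀ z → ∑[ w < m ] b2n (does (g z ≟ w) ∧ f z) ≡ b2n (f z)
  indicator z = begin
    ∑[ w < m ] b2n (does (g z ≟ w) ∧ f z)
      ≡⟨ count≡∑ m _ ⟨
    count m (λ w → does (g z ≟ w) ∧ f z)
      ≡⟨ count-∧-const (λ w → does (g z ≟ w)) (f z) ⟩
    b2n (f z) * count m (λ w → does (g z ≟ w))
      ≡⟨ cong (b2n (f z) *_) (count-unique (g z ≟_) (g z) (λ _ → mk⇔ sym sym)) ⟩
    b2n (f z) * 1
      ≡⟨ *-identityʳ _ ⟩
    b2n (f z) ∎

least : ∀ {n} {P : Pred (Fin n) ℓ} → Decidable P → ∀ {z} → P z →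
        ∃[ a ] P a × (∀ {j} → P j → a Fin.≤ j)
least {n = suc n} P? {z} Pz with P? zero
... | yes P₀ = zero , P₀ , λ _ → z≤n
... | no ¬P₀ with z
...   | zero  = ⊥-elim (¬P₀ Pz)
...   | suc z′ with least (P? ∘ suc) Pz
...     | a , Pa , a-least =
  suc a , Pa , λ { {zero} P₀ → ⊥-elim (¬P₀ P₀) ; {suc j} Pj → s≤s (a-least Pj) }

module _ {n} {_~_ : Rel (Fin n) ℓ} (~-isEquivalence : IsEquivalence _~_) (_~?_ : Decidable₂ _~_) where

  open IsEquivalence ~-isEquivalence renaming (refl to ~-refl; sym to ~-sym; trans to ~-trans)

  private
    leader : Fin n → Fin n
    leader z = proj₁ (least (_~? z) ~-refl)

    leader~ : ∀ z → leader z ~ z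
    leader~ z = proj₁ (proj₂ (least (_~? z) ~-refl))

    leader-least : ∀ {x z} → x ~ z → leader z Fin.≤ x
    leader-least {z = z} = proj₂ (proj₂ (least (_~? z) ~-refl))

    leader-cong : ∀ {z z′} → z ~ z′ → leader z ≡ leader z′
    leader-cong {z} {z′} z~z′ = Fin.≤-antisym
      (leader-least (~-trans (leader~ z′) (~-sym z~z′)))
      (leader-least (~-trans (leader~ z) z~z′))

    leader-of-class : ∀ z x → (x ~ z × leader x ≡ x) ⇔ x ≡ leader z
    leader-of-class z x = mk⇔
      (λ (x~z , leader-x≡x) → trans (sym leader-x≡x) (leader-cong x~z))
      (λ { refl → leader~ z , leader-cong (leader~ z) })

  ∣classSizes⇒∣n : ∀ {q} → (∀ x → q ∣ count n (λ z → does (x ~? z))) → q ∣ n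
  ∣classSizes⇒∣n {q} q∣size =
    subst (q ∣_) (sym n≡∑leaders) (∑-∣ (λ x → ∣n⇒∣m*n (b2n (isLeader x)) (q∣size x)))
    where
    isLeader : Fin n → Bool
    isLeader x = does (leader x ≟ x)

    n≡∑leaders : n ≡ ∑[ x < n ] (b2n (isLeader x) * count n (λ z → does (x ~? z)))
    n≡∑leaders = begin
      n
        ≡⟨ trans (∑-const n 1) (*-identityʳ n) ⟨
      ∑[ z < n ] 1
        ≡⟨ sum-cong-≗ {n} (λ z →
             count-unique (λ x → (x ~? z) ×-dec (leader x ≟ x)) _ (leader-of-class z)) ⟨
      ∑[ z < n ] count n (λ x → does (x ~? z) ∧ isLeader x)
        ≡⟨ sum-cong-≗ {n} (λ z → count≡∑ n (λ x → does (x ~? z) ∧ isLeader x)) ⟩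
      ∑[ z < n ] ∑[ x < n ] b2n (does (x ~? z) ∧ isLeader x)
        ≡⟨ ∑-comm {n} {n} _ ⟩
      ∑[ x < n ] ∑[ z < n ] b2n (does (x ~? z) ∧ isLeader x)
        ≡⟨ sum-cong-≗ {n} (λ x → count≡∑ n (λ z → does (x ~? z) ∧ isLeader x)) ⟨
      ∑[ x < n ] count n (λ z → does (x ~? z) ∧ isLeader x)
        ≡⟨ sum-cong-≗ {n} (λ x → count-∧-const (λ z → does (x ~? z)) (isLeader x)) ⟩
      ∑[ x < n ] (b2n (isLeader x) * count n (λ z → does (x ~? z))) ∎

module _ (S : AssocScheme) where

  open AssocScheme S renaming (trans to rel-transpose)

  star-involutive : ∀ i → star (star i) ≡ i
  star-involutive i with nonempty i
  ... | x , y , refl = sym (trans (rel-transpose y x) (cong star (rel-transpose x y)))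

  star-injective : ∀ {i j} → star i ≡ star j → i ≡ j
  star-injective {i} {j} e = trans (sym (star-involutive i)) (trans (cong star e) (star-involutive j))

  rel-transpose-≡ : ∀ x z i → rel x z ≡ star i ⇔ rel z x ≡ i
  rel-transpose-≡ x z i = mk⇔
    (λ e → star-injective (trans (sym (rel-transpose z x)) e))
    (λ e → trans (rel-transpose z x) (cong star e))

  rel-refl : ∀ x → rel x x ≡ zero
  rel-refl x = Equivalence.from (diag x x) refl

  -- `inter` is stated with ⌊_⌋ = isYes, which agrees with `does` only propositionally.
  inter-does : ∀ i j x y →
               count n (λ z → does (rel x z ≟ i) ∧ does (rel z y ≟ j)) ≡ p i j (rel x y)
  inter-does i j x y = trans
    (count-cong (λ z → sym (cong₂ _∧_ (isYes≗does (rel x z ≟ i)) (isYes≗does (rel z y ≟ j)))))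
    (inter i j x y)

  p-positive : ∀ x y z → 0 < p (rel x y) (rel y z) (rel x z)
  p-positive x y z = subst (0 <_) (inter-does (rel x y) (rel y z) x z)
    (count-pos (λ w → (rel x w ≟ rel x y) ×-dec (rel w z ≟ rel y z)) (refl , refl))

  p-positive′ : ∀ {x y z u v l} → rel x y ≡ u → rel y z ≡ v → rel x z ≡ l → 0 < p u v l
  p-positive′ {x} {y} {z} refl refl refl = p-positive x y z

  count-rel≡k : ∀ x i → count n (λ z → does (rel x z ≟ i)) ≡ k i
  count-rel≡k x i = begin
    count n (λ z → does (rel x z ≟ i))                           ≡⟨ count-cong both-directions ⟩
    count n (λ z → does (rel x z ≟ i) ∧ does (rel z x ≟ star i)) ≡⟨ inter-does i (star i) x x ⟩
    p i (star i) (rel x x)                                       ≡⟨ cong (p i (star i)) (rel-refl x) ⟩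
    k i                                                          ∎
    where
    both-directions : ∀ z → does (rel x z ≟ i) ≡ does (rel x z ≟ i) ∧ does (rel z x ≟ star i)
    both-directions z with rel x z ≟ i
    ... | yes refl = sym (dec-true (rel z x ≟ star (rel x z)) (rel-transpose x z))
    ... | no _     = refl

  count-rel∈ : {P : Pred (Fin (suc d)) ℓ} (P? : Decidable P) (x : Fin n) →
               count n (λ z → does (P? (rel x z))) ≡ ∑[ i < suc d ] (b2n (does (P? i)) * k i)
  count-rel∈ P? x = begin
    count n (λ z → does (P? (rel x z)))
      ≡⟨ count-fibres (rel x) _ ⟩
    ∑[ i < suc d ] count n (λ z → does (rel x z ≟ i) ∧ does (P? (rel x z)))
      ≡⟨ sum-cong-≗ {suc d} (count-cong ∘ fibre) ⟩
    ∑[ i < suc d ] count n (λ z → does (rel x z ≟ i) ∧ does (P? i))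
      ≡⟨ sum-cong-≗ {suc d} (λ i → count-∧-const (λ z → does (rel x z ≟ i)) (does (P? i))) ⟩
    ∑[ i < suc d ] (b2n (does (P? i)) * count n (λ z → does (rel x z ≟ i)))
      ≡⟨ sum-cong-≗ {suc d} (λ i → cong (b2n (does (P? i)) *_) (count-rel≡k x i)) ⟩
    ∑[ i < suc d ] (b2n (does (P? i)) * k i) ∎
    where
    fibre : ∀ i z → does (rel x z ≟ i) ∧ does (P? (rel x z)) ≡ does (rel x z ≟ i) ∧ does (P? i)
    fibre i z with rel x z ≟ i
    ... | yes refl = refl
    ... | no _     = refl

  k-star : ∀ i → k (star i) ≡ k i
  k-star i with nonempty i
  ... | x₀ , _ = *-cancelˡ-≡ _ _ n {{nonZeroIndex x₀}} (begin
    n * k (star i)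
      ≡⟨ ∑-const n _ ⟨
    ∑[ x < n ] k (star i)
      ≡⟨ sum-cong-≗ {n} (λ x → count-rel≡k x (star i)) ⟨
    ∑[ x < n ] count n (λ z → does (rel x z ≟ star i))
      ≡⟨ sum-cong-≗ {n} (λ x → count≡∑ n (λ z → does (rel x z ≟ star i))) ⟩
    ∑[ x < n ] ∑[ z < n ] b2n (does (rel x z ≟ star i))
      ≡⟨ ∑-comm {n} {n} _ ⟩
    ∑[ z < n ] ∑[ x < n ] b2n (does (rel x z ≟ star i))
      ≡⟨ sum-cong-≗ {n} (λ z → sum-cong-≗ {n} (λ x →
           cong b2n (does-⇔ (rel-transpose-≡ x z i) (rel x z ≟ star i) (rel z x ≟ i)))) ⟩
    ∑[ z < n ] ∑[ x < n ] b2n (does (rel z x ≟ i))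
      ≡⟨ sum-cong-≗ {n} (λ z → count≡∑ n (λ x → does (rel z x ≟ i))) ⟨
    ∑[ z < n ] count n (λ x → does (rel z x ≟ i))
      ≡⟨ sum-cong-≗ {n} (λ z → count-rel≡k z i) ⟩
    ∑[ z < n ] k i
      ≡⟨ ∑-const n _ ⟩
    n * k i ∎)

  thinRadical-star : ∀ {i} → thinRadical i → thinRadical (star i)
  thinRadical-star {i} = trans (k-star i)

  module _ {T : Subset (suc d)} (T-closed : Closed T) where

    closed⇒zero∈ : zero ∈ T
    closed⇒zero∈ with proj₁ T-closed
    ... | t , t∈T with nonempty t
    ...   | a , b , ab≡t = proj₂ T-closed zero
      ( star t , t , subst (_∈ T) (sym (star-involutive t)) t∈T , t∈T
      , p-positive′ (trans (rel-transpose a b) (cong star ab≡t)) ab≡t (rel-refl b))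

    closed⇒star∈ : ∀ {i} → i ∈ T → star i ∈ T
    closed⇒star∈ {i} i∈T with nonempty (star i)
    ... | x , y , xy≡i* = proj₂ T-closed (star i)
      ( star i , zero , subst (_∈ T) (sym (star-involutive i)) i∈T , closed⇒zero∈
      , p-positive′ xy≡i* (rel-refl y) xy≡i*)

    closed⇒·-closed : ∀ {u v l} → u ∈ T → v ∈ T → 0 < p u v l → l ∈ T
    closed⇒·-closed u∈T v∈T uvl = proj₂ T-closed _ (_ , _ , closed⇒star∈ u∈T , v∈T , uvl)

    closed⇒rel-trans : ∀ {x z y} → rel x z ∈ T → rel z y ∈ T → rel x y ∈ T
    closed⇒rel-trans {x} {z} {y} xz∈T zy∈T = closed⇒·-closed xz∈T zy∈T (p-positive x z y)

  stronglyNormal⇒rel∈ : ∀ {T} → StronglyNormalClosed T →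
                         ∀ {y z z′} → rel y z ≡ rel y z′ → rel z z′ ∈ T
  stronglyNormal⇒rel∈ (T-closed , T-normal) {y} {z} {z′} yz≡yz′ =
    T-normal (rel y z′) (rel z z′)
      ( rel z y , rel y z′
      , (rel z y , zero , trans (rel-transpose y z) (cong star yz≡yz′) , closed⇒zero∈ T-closed
        , p-positive′ refl (rel-refl y) refl)
      , refl , p-positive z y z′)

  ⊤-stronglyNormalClosed : StronglyNormalClosed ⊤
  ⊤-stronglyNormalClosed = ((zero , ∈⊤) , λ _ _ → ∈⊤) , λ _ _ _ → ∈⊤

  _·?_ : {U V : Fin (suc d) → Set} → Decidable U → Decidable V → Decidable (U · V)
  (U? ·? V?) l = any? (λ u → any? (λ v → U? u ×-dec V? v ×-dec (0 ℕ.<? p u v l)))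

  closed? : Decidable Closed
  closed? T = nonempty? T ×-dec all? (λ l → ((λ u → star u ∈? T) ·? (_∈? T)) l →-dec (l ∈? T))

  stronglyNormalClosed? : Decidable StronglyNormalClosed
  stronglyNormalClosed? T = closed? T ×-dec all? (λ i → all? (λ l →
    (((_≟ star i) ·? (_∈? T)) ·? (_≟ i)) l →-dec (l ∈? T)))

  -- abstract: otherwise the checker unfolds this search through all subsets of S
  abstract
    thinResidue? : Decidable thinResidue
    thinResidue? i with anySubset? (λ T → stronglyNormalClosed? T ×-dec ¬? (i ∈? T))
    ... | yes (T , T-snc , i∉T) = no (λ i∈O^θ → i∉T (i∈O^θ T T-snc))
    ... | no ∄T = yes (λ T T-snc → decidable-stable (i ∈? T) (λ i∉T → ∄T (T , T-snc , i∉T)))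

  thinRadical? : Decidable thinRadical
  thinRadical? i = k i ℕ.≟ 1

  thinResidue-isEquivalence : IsEquivalence (λ x z → thinResidue (rel x z))
  thinResidue-isEquivalence = record
    { refl  = λ {x} T T-snc → subst (_∈ T) (sym (rel-refl x)) (closed⇒zero∈ (proj₁ T-snc))
    ; sym   = λ {x} {z} xz T T-snc →
                subst (_∈ T) (sym (rel-transpose x z)) (closed⇒star∈ (proj₁ T-snc) (xz T T-snc))
    ; trans = λ xz zy T T-snc → closed⇒rel-trans (proj₁ T-snc) (xz T T-snc) (zy T T-snc)
    }

  thinResidue-normal : ∀ {y z z′} → rel y z ≡ rel y z′ → thinResidue (rel z z′)
  thinResidue-normal yz≡yz′ T T-snc = stronglyNormal⇒rel∈ T-snc yz≡yz′

  module _ {q} (q∣k : ∀ i → ¬ thinRadical i → q ∣ k i) where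

    q∣thinResidueClass : ∀ x y → ¬ (∃[ z ] thinResidue (rel x z) × thinRadical (rel z y)) →
                         q ∣ count n (λ z → does (thinResidue? (rel x z)))
    q∣thinResidueClass x y ∄z = subst (q ∣_) (sym (count-fibres (rel y) _)) (∑-∣ q∣fibre)
      where
      open IsEquivalence thinResidue-isEquivalence using () renaming (trans to thinResidue-trans)

      q∣fibre : ∀ w → q ∣ count n (λ z → does (rel y z ≟ w) ∧ does (thinResidue? (rel x z)))
      q∣fibre w with any? (λ z → (rel y z ≟ w) ×-dec thinResidue? (rel x z))
      ... | no empty = subst (q ∣_) (sym (count-false (λ z →
              dec-false ((rel y z ≟ w) ×-dec thinResidue? (rel x z)) (λ h → empty (z , h)))))
            (q ∣0)
      ... | yes (z₀ , yz₀≡w , xNz₀) = subst (q ∣_) (sym fibre≡k) (q∣k w w-not-thin)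
        where
        fibre≡k : count n (λ z → does (rel y z ≟ w) ∧ does (thinResidue? (rel x z))) ≡ k w
        fibre≡k = trans
          (count-cong (λ z → does-⇔ (mk⇔ proj₁ (λ yz≡w →
            yz≡w , thinResidue-trans xNz₀ (thinResidue-normal (trans yz₀≡w (sym yz≡w)))))
              ((rel y z ≟ w) ×-dec thinResidue? (rel x z)) (rel y z ≟ w)))
          (count-rel≡k y w)

        w-not-thin : ¬ thinRadical w
        w-not-thin w-thin = ∄z (z₀ , xNz₀ ,
          subst thinRadical (sym (Equivalence.from (rel-transpose-≡ z₀ y w) yz₀≡w))
            (thinRadical-star w-thin))

    thinResidue·thinRadical≡S : q ∤ n → ∀ i → (thinResidue · thinRadical) i
    thinResidue·thinRadical≡S q∤n i with nonempty i
    ... | x , y , refl with any? (λ z → thinResidue? (rel x z) ×-dec thinRadical? (rel z y))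
    ...   | yes (z , xz∈O^θ , zy∈Oθ) = rel x z , rel z y , xz∈O^θ , zy∈Oθ , p-positive x z y
    ...   | no ∄z = ⊥-elim (q∤n
      (∣classSizes⇒∣n thinResidue-isEquivalence (λ x z → thinResidue? (rel x z))
        (λ x′ → subst (q ∣_) (class-size x′) (q∣thinResidueClass x y ∄z))))
      where
      class-size : ∀ x′ → count n (λ z → does (thinResidue? (rel x z)))
                        ≡ count n (λ z → does (thinResidue? (rel x′ z)))
      class-size x′ = trans (count-rel∈ thinResidue? x) (sym (count-rel∈ thinResidue? x′))

  stronglyNormalClosed⊇thinRadical⇒≡⊤ : (∀ i → (thinResidue · thinRadical) i) →
    ∀ {T} → StronglyNormalClosed T → (∀ i → thinRadical i → i ∈ T) → T ≡ ⊤
  stronglyNormalClosed⊇thinRadical⇒≡⊤ S≡O^θOθ {T} T-snc Oθ⊆T =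
    ⊆-antisym (λ _ → ∈⊤) (λ {i} _ → i∈T i)
    where
    i∈T : ∀ i → i ∈ T
    i∈T i with S≡O^θOθ i
    ... | u , v , u∈O^θ , v∈Oθ , uvi =
      closed⇒·-closed (proj₁ T-snc) (u∈O^θ T T-snc) (Oθ⊆T v v∈Oθ) uvi

corollary3p11 : (S : AssocScheme) (p : ℕ) → Prime p →
    (∀ i → ¬ AssocScheme.thinRadical S i → p ∣ AssocScheme.k S i) →
    p ∤ AssocScheme.n S →
    (∀ i → (AssocScheme._·_ S (AssocScheme.thinResidue S) (AssocScheme.thinRadical S)) i)
    × AssocScheme.StronglyNormalClosed S ⊤
    × (∀ (T : Subset (suc (AssocScheme.d S))) → AssocScheme.StronglyNormalClosed S T →
         (∀ i → AssocScheme.thinRadical S i → i ∈ T) → T ≡ ⊤)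
corollary3p11 S p _ p∣k p∤n =
    S≡O^θOθ
  , ⊤-stronglyNormalClosed S
  , λ T → stronglyNormalClosed⊇thinRadical⇒≡⊤ S S≡O^θOθ {T}
  where
  S≡O^θOθ : ∀ i → AssocScheme._·_ S (AssocScheme.thinResidue S) (AssocScheme.thinRadical S) i
  S≡O^θOθ = thinResidue·thinRadical≡S S p∣k p∤n
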